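{- Let $\alpha=(13384+8\sqrt{2793745})^{1/22}$. There exist a constant $c>0$ and an integer $n_0$ such that for every $n\ge n_0$ there is a tree with $n$ nodes, maximum degree at most 3 and no two adjacent degree-2 nodes, having at least $c\,\alpha^n$ legal matchings. In particular, $M_n=\Omega(\alpha^n)$, where $M_n$ is the maximum number of legal matchings in a tree with $n$ nodes and maximum degree at most 3.
   Context: Trees are arbitrary finite trees; $n$ is the total number of nodes. A matching is a set of pairwise disjoint edges. For a matching $M$ of a tree $T$, $T-M$ is the forest obtained by deleting the edges of $M$. $M$ is legal if $T-M$ has no connected component consisting of exactly one edge $uv$ with both $u$ and $v$ incident to edges of $M$. -}

module Defs where

open import Data.Nat using (ℕ; zero; suc; _+_; _*_; _∸_; _^_; _≤_)
open import Data.Bool using (Bool; true; false)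
open import Data.Fin using (Fin)
open import Data.List using (List; []; _∷_; length; filterᵇ; allFin; _∷ʳ_)
open import Data.List.Relation.Unary.Linked using (Linked)
open import Data.List.Relation.Unary.Unique.Propositional using (Unique)
open import Data.List.Relation.Unary.All using (All)
open import Data.List.Relation.Unary.AllPairs using (AllPairs)
open import Data.Product using (Σ; ∃; ∃-syntax; _×_; _,_)
open import Relation.Binary.PropositionalEquality using (_≡_; _≢_)
open import Relation.Nullary using (¬_)

record Graph (n : ℕ) : Set where
  field
    adj    : Fin n → Fin n → Bool
    sym    : ∀ u v → adj u v ≡ adj v u
    irrefl : ∀ u → adj u u ≡ false

module _ {n : ℕ} (G : Graph n) where
  open Graph G

  Adj : Fin n → Fin n → Set
  Adj u v = adj u v ≡ true

  deg : Fin n → ℕ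
  deg v = length (filterᵇ (adj v) (allFin n))

  data Walk : Fin n → Fin n → Set where
    [] : ∀ {u} → Walk u u
    _∷_ : ∀ {u w v} → Adj u w → Walk w v → Walk u v

  Connected : Set
  Connected = ∀ u v → Walk u v

  Cycle : Set
  Cycle = Σ (Fin n) λ u → Σ (List (Fin n)) λ ys →
            (2 ≤ length ys) × Unique (u ∷ ys) × Linked Adj ((u ∷ ys) ∷ʳ u)

  Acyclic : Set
  Acyclic = ¬ Cycle

  IsTree : Set
  IsTree = Connected × Acyclic

  MaxDegreeAtMost3 : Set
  MaxDegreeAtMost3 = ∀ v → deg v ≤ 3

  NoAdjacentDegree2 : Set
  NoAdjacentDegree2 = ∀ u v → Adj u v → ¬ (deg u ≡ 2 × deg v ≡ 2)

  EdgeSet : Set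
  EdgeSet = Fin n → Fin n → Bool

  IsMatching : EdgeSet → Set
  IsMatching M = (∀ u v → M u v ≡ M v u)
               × (∀ u v → M u v ≡ true → Adj u v)
               × (∀ u v w → M u v ≡ true → M u w ≡ true → v ≡ w)

  AdjMinus : EdgeSet → Fin n → Fin n → Set
  AdjMinus M u v = Adj u v × M u v ≡ false

  Covered : EdgeSet → Fin n → Set
  Covered M u = ∃[ w ] M u w ≡ true

  -- The connected component of G − M containing the edge uv is exactly
  -- {u , v} with the single edge uv (G is a tree, so no other edges).
  SingleEdgeComponent : EdgeSet → Fin n → Fin n → Set
  SingleEdgeComponent M u v =
      AdjMinus M u v
    × (∀ w → AdjMinus M u w → w ≡ v)
    × (∀ w → AdjMinus M v w → w ≡ u)

  IsLegal : EdgeSet → Set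
  IsLegal M = ¬ (∃[ u ] ∃[ v ] (SingleEdgeComponent M u v × Covered M u × Covered M v))

  IsLegalMatching : EdgeSet → Set
  IsLegalMatching M = IsMatching M × IsLegal M

  DistinctEdgeSets : EdgeSet → EdgeSet → Set
  DistinctEdgeSets M₁ M₂ = ∃[ u ] ∃[ v ] M₁ u v ≢ M₂ u v

  AtLeastLegalMatchings : ℕ → Set
  AtLeastLegalMatchings K = Σ (List EdgeSet) λ Ms →
      length Ms ≡ K × All IsLegalMatching Ms × AllPairs DistinctEdgeSets Ms

-- X ≥ A + B·√D  (for naturals X, A, B, D)
GeqSurd : ℕ → ℕ → ℕ → ℕ → Set
GeqSurd X A B D = (A ≤ X) × (B * B * D ≤ (X ∸ A) * (X ∸ A))

D₀ : ℕ
D₀ = 2793745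

-- β = 13384 + 8√D₀ = α²²;  βPow k = (a , b) with β^k = a + b√D₀
βPow : ℕ → ℕ × ℕ
βPow zero = 1 , 0
βPow (suc k) with βPow k
... | a , b = 13384 * a + 8 * b * D₀ , 8 * a + 13384 * b

-- K ≥ (p/q)·α^n, i.e. (q·K)²² ≥ p²² · β^n
GeqCAlphaPow : ℕ → ℕ → ℕ → ℕ → Set
GeqCAlphaPow K p q n with βPow n
... | a , b = GeqSurd ((q * K) ^ 22) (p ^ 22 * a) (p ^ 22 * b) D₀

{-# OPTIONS --safe #-}
-- Trees are assembled from small pieces by joining the port of one piece to the port of
-- another by a bridge edge.  The matchings of a piece are split by whether they avoid its
-- port; extending a chain by a branch whose split is (u′, c′) transforms the split (u, c) of
-- the chain by the matrix ((u′, u′), (u′ + c′, c′)).  Six such steps form a 22-vertex gadget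
-- with transfer matrix T = ((20336, 13456), (9696, 6432)), whose Perron root is
-- β = 13384 + 8√2793745 = α²².  All degrees stay at most 3 and no two degree-2 nodes are
-- adjacent, which makes every matching legal.  Writing β^k = A k + B k √D₀, the map
-- (a, b) ↦ (a + 869 b, 1212 b) carries multiplication by β to T, so k gadgets give at least
-- A k matchings, while β^n ≤ 3 A n ≤ (c · A k)²² for n = r + 22 k with r ≤ 26 and a constant c.
--
-- That the graphs are trees is certified by a levelling: a height function for which every
-- vertex but the root has exactly one lower neighbour; the highest vertex of a cycle would
-- have two.

module Submission where

open import Defs
open import Data.Bool using (Bool; true; false; _∧_; _∨_; if_then_else_)
open import Data.Bool.Properties using (T?; ∧-comm; ∧-identityʳ)
open import Data.Empty using (⊥; ⊥-elim)
open import Data.Fin as Fin using (Fin; splitAt; join; _↑ˡ_; _↑ʳ_)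
open import Data.Fin.Properties using (_≟_; splitAt-↑ˡ; splitAt-↑ʳ; splitAt⁻¹-↑ˡ; splitAt⁻¹-↑ʳ; splitAt-join; join-splitAt; ↑ˡ-injective; ↑ʳ-injective)
open import Data.List using (List; []; _∷_; _++_; _∷ʳ_; length; map; filterᵇ; allFin; tabulate; cartesianProductWith; initLast; _∷ʳ′_)
open import Data.List.Properties using (length-++; length-map; filter-++; cartesianProductWith-distribʳ-++; ++-assoc)
open import Data.List.Relation.Unary.All as All using (All; []; _∷_)
import Data.List.Relation.Unary.All.Properties as Allₚ
open import Data.List.Relation.Unary.AllPairs as AllPairs using (AllPairs; []; _∷_)
import Data.List.Relation.Unary.AllPairs.Properties as AllPairsₚ
open import Data.List.Relation.Unary.Linked as Linked using (Linked; []; [-]; _∷_)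
open import Data.List.Relation.Unary.Linked.Properties using (Linked⇒All)
open import Data.List.Relation.Unary.Unique.Propositional using (Unique)
open import Data.Nat using (ℕ; zero; suc; _+_; _*_; _∸_; _^_; _≤_; _<_; _≥_; _≤′_; ≤′-refl; ≤′-step; z≤n; s≤s)
open import Data.Nat.DivMod using (_%_; _/_; m≡m%n+[m/n]*n; m%n<n)
open import Data.Nat.Properties hiding (_≟_)
open import Data.Nat.Tactic.RingSolver using (solve-∀)
open import Data.Product using (Σ; ∃; ∃-syntax; _×_; _,_; proj₁; proj₂)
open import Data.Sum using (_⊎_; inj₁; inj₂; [_,_])
open import Data.Unit using (⊤; tt)
open import Function using (_∘_; _∘′_)
open import Relation.Binary.PropositionalEquality hiding ([_])
open import Relation.Nullary using (¬_; does; yes; no)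
open import Relation.Nullary.Decidable using (dec-true; dec-false)

count : ∀ {n} → (Fin n → Bool) → ℕ
count {n} p = length (filterᵇ p (allFin n))

length-filterᵇ-tabulate : ∀ {A B : Set} {n} {p : A → Bool} {q : B → Bool} (f : Fin n → A) (g : Fin n → B) →
                          (∀ i → p (f i) ≡ q (g i)) →
                          length (filterᵇ p (tabulate f)) ≡ length (filterᵇ q (tabulate g))
length-filterᵇ-tabulate {n = zero} f g eq = refl
length-filterᵇ-tabulate {n = suc n} {p} {q} f g eq with p (f Fin.zero) | q (g Fin.zero) | eq Fin.zero
... | true  | true  | _ = cong suc (length-filterᵇ-tabulate (f ∘ Fin.suc) (g ∘ Fin.suc) (eq ∘ Fin.suc))
... | false | false | _ = length-filterᵇ-tabulate (f ∘ Fin.suc) (g ∘ Fin.suc) (eq ∘ Fin.suc)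

count-cong : ∀ {n} {p q : Fin n → Bool} → (∀ i → p i ≡ q i) → count p ≡ count q
count-cong = length-filterᵇ-tabulate _ _

count-suc : ∀ {n} (p : Fin (suc n) → Bool) → count p ≡ (if p Fin.zero then 1 else 0) + count (p ∘ Fin.suc)
count-suc p with p Fin.zero
... | true  = cong suc (length-filterᵇ-tabulate {p = p} {q = p ∘ Fin.suc} Fin.suc (λ i → i) λ _ → refl)
... | false = length-filterᵇ-tabulate {p = p} {q = p ∘ Fin.suc} Fin.suc (λ i → i) λ _ → refl

count-false : ∀ {n} → count {n} (λ _ → false) ≡ 0
count-false {zero}  = refl
count-false {suc n} = trans (count-suc {n} (λ _ → false)) (count-false {n})

count-≟ : ∀ {n} (v : Fin n) → count (λ u → does (u ≟ v)) ≡ 1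
count-≟ {suc n} Fin.zero     = trans (count-suc {n} (λ u → does (u ≟ Fin.zero))) (cong suc (count-false {n}))
count-≟ {suc n} (Fin.suc v) = trans (count-suc {n} (λ u → does (u ≟ Fin.suc v))) (count-≟ {n} v)

length-filterᵇ-∨ : ∀ {A : Set} (p q : A → Bool) → (∀ x → p x ∧ q x ≡ false) → ∀ xs →
                   length (filterᵇ (λ x → p x ∨ q x) xs) ≡ length (filterᵇ p xs) + length (filterᵇ q xs)
length-filterᵇ-∨ p q disjoint []       = refl
length-filterᵇ-∨ p q disjoint (x ∷ xs) with p x | q x | disjoint x | length-filterᵇ-∨ p q disjoint xs
... | true  | false | _ | ih = cong suc ih
... | false | true  | _ | ih = trans (cong suc ih) (sym (+-suc _ _))
... | false | false | _ | ih = ih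

count-∨ : ∀ {n} (p q : Fin n → Bool) → (∀ i → p i ∧ q i ≡ false) → count (λ i → p i ∨ q i) ≡ count p + count q
count-∨ {n} p q disjoint = length-filterᵇ-∨ p q disjoint (allFin n)

count-if-≟ : ∀ {n} (c : Bool) (v : Fin n) → count (λ u → c ∧ does (u ≟ v)) ≡ (if c then 1 else 0)
count-if-≟ true  v = count-≟ v
count-if-≟ {n} false v = count-false {n}

tabulate-↑ : ∀ {A : Set} m {k} (g : Fin (m + k) → A) → tabulate g ≡ tabulate (g ∘ (_↑ˡ k)) ++ tabulate (g ∘ (m ↑ʳ_))
tabulate-↑ zero    g = refl
tabulate-↑ (suc m) g = cong (g Fin.zero ∷_) (tabulate-↑ m (g ∘ Fin.suc))

count-↑ : ∀ m {k} (p : Fin (m + k) → Bool) → count p ≡ count (p ∘ (_↑ˡ k)) + count (p ∘ (m ↑ʳ_))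
count-↑ m {k} p = begin
  count p                                                                 ≡⟨ cong (length ∘ filterᵇ p) (tabulate-↑ m (λ i → i)) ⟩
  length (filterᵇ p (tabulate (_↑ˡ k) ++ tabulate (m ↑ʳ_)))               ≡⟨ cong length (filter-++ (T? ∘ p) (tabulate (_↑ˡ k)) _) ⟩
  length (filterᵇ p (tabulate (_↑ˡ k)) ++ filterᵇ p (tabulate (m ↑ʳ_)))   ≡⟨ length-++ (filterᵇ p (tabulate (_↑ˡ k))) ⟩
  length (filterᵇ p (tabulate (_↑ˡ k))) + length (filterᵇ p (tabulate (m ↑ʳ_)))
    ≡⟨ cong₂ _+_ (length-filterᵇ-tabulate {q = p ∘ (_↑ˡ k)} _ (λ i → i) (λ _ → refl))
                 (length-filterᵇ-tabulate {q = p ∘ (m ↑ʳ_)} _ (λ i → i) (λ _ → refl)) ⟩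
  count (p ∘ (_↑ˡ k)) + count (p ∘ (m ↑ʳ_))                              ∎
  where open ≡-Reasoning

Linked-∷ʳ⁻ : ∀ {A : Set} {R : A → A → Set} xs {y z} → Linked R (xs ∷ʳ y ∷ʳ z) → Linked R (xs ∷ʳ y) × R y z
Linked-∷ʳ⁻ []            (r ∷ [-]) = [-] , r
Linked-∷ʳ⁻ (x ∷ [])      (r ∷ rs)  = r ∷ proj₁ (Linked-∷ʳ⁻ [] rs) , proj₂ (Linked-∷ʳ⁻ [] rs)
Linked-∷ʳ⁻ (x ∷ x′ ∷ xs) (r ∷ rs)  = r ∷ proj₁ (Linked-∷ʳ⁻ (x′ ∷ xs) rs) , proj₂ (Linked-∷ʳ⁻ (x′ ∷ xs) rs)

Unique-rotate : ∀ {A : Set} {x : A} xs → Unique (x ∷ xs) → Unique (xs ∷ʳ x)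
Unique-rotate []       _                        = [] ∷ []
Unique-rotate (y ∷ ys) ((x≢y ∷ x∉ys) ∷ y∉ys ∷ U) =
  Allₚ.∷ʳ⁺ y∉ys (λ y≡x → x≢y (sym y≡x)) ∷ Unique-rotate ys (x∉ys ∷ U)

All-∷ʳ-last : ∀ {A : Set} {P : A → Set} {xs x} → All P (xs ∷ʳ x) → P x
All-∷ʳ-last p = proj₂ (Allₚ.∷ʳ⁻ p)

All-∷ʳ-init : ∀ {A : Set} {P : A → Set} {xs x} → All P (xs ∷ʳ x) → All P xs
All-∷ʳ-init p = proj₁ (Allₚ.∷ʳ⁻ p)

false≢true : false ≢ true
false≢true ()

∧-true⁻ : ∀ x {y} → x ∧ y ≡ true → x ≡ true × y ≡ true
∧-true⁻ true {true} _ = refl , refl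

module _ {A B C : Set} (f : A → B → C) where

  length-cartesianProductWith : ∀ xs ys → length (cartesianProductWith f xs ys) ≡ length xs * length ys
  length-cartesianProductWith []       ys = refl
  length-cartesianProductWith (x ∷ xs) ys =
    trans (length-++ (map (f x) ys)) (cong₂ _+_ (length-map (f x) ys) (length-cartesianProductWith xs ys))

  All-cartesianProductWith⁺ : ∀ {P : A → Set} {Q : B → Set} {R : C → Set} →
                              (∀ {x y} → P x → Q y → R (f x y)) →
                              ∀ {xs ys} → All P xs → All Q ys → All R (cartesianProductWith f xs ys)
  All-cartesianProductWith⁺ pres []         qys = []
  All-cartesianProductWith⁺ pres (px ∷ pxs) qys =
    Allₚ.++⁺ (Allₚ.map⁺ (All.map (pres px) qys)) (All-cartesianProductWith⁺ pres pxs qys)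

  All-cartesianProductWith-universal : ∀ {R : C → Set} → (∀ x y → R (f x y)) →
                                       ∀ xs ys → All R (cartesianProductWith f xs ys)
  All-cartesianProductWith-universal holds []       ys = []
  All-cartesianProductWith-universal holds (x ∷ xs) ys =
    Allₚ.++⁺ (Allₚ.map⁺ (All.universal (holds x) ys)) (All-cartesianProductWith-universal holds xs ys)

  AllPairs-cartesianProductWith⁺ : ∀ {S : A → A → Set} {T : B → B → Set} {R : C → C → Set} →
                                   (∀ {x x′ y y′} → S x x′ → R (f x y) (f x′ y′)) →
                                   (∀ {x y y′} → T y y′ → R (f x y) (f x y′)) →
                                   ∀ {xs ys} → AllPairs S xs → AllPairs T ys → AllPairs R (cartesianProductWith f xs ys)
  AllPairs-cartesianProductWith⁺ presˡ presʳ []           Tys = []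
  AllPairs-cartesianProductWith⁺ {R = R} presˡ presʳ {x ∷ xs} {ys} (Sx ∷ Sxs) Tys =
    AllPairsₚ.++⁺ (AllPairsₚ.map⁺ (AllPairs.map presʳ Tys))
                  (AllPairs-cartesianProductWith⁺ presˡ presʳ Sxs Tys)
                  (Allₚ.map⁺ (All.universal before-rest ys))
    where
      before-rest : ∀ y → All (R (f x y)) (cartesianProductWith f xs ys)
      before-rest y = All-cartesianProductWith⁺ {Q = λ _ → ⊤} (λ Sxx′ _ → presˡ Sxx′) Sx (All.universal (λ _ → tt) ys)

AllPairs-++⁻ : ∀ {A : Set} {R : A → A → Set} xs {ys} → AllPairs R (xs ++ ys) →
               AllPairs R xs × AllPairs R ys × All (λ x → All (R x) ys) xs
AllPairs-++⁻ []       Rys = [] , Rys , []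
AllPairs-++⁻ (x ∷ xs) (Rx ∷ Rxsys) with AllPairs-++⁻ xs Rxsys
... | Rxs , Rys , Rxsys′ = Allₚ.++⁻ˡ xs Rx ∷ Rxs , Rys , Allₚ.++⁻ʳ xs Rx ∷ Rxsys′

-- Trees from levellings

≡-suc⇒< : ∀ {a b} → b ≡ suc a → a < b
≡-suc⇒< e = ≤-reflexive (sym e)

adj-sym : ∀ {n} (G : Graph n) {u v} → Adj G u v → Adj G v u
adj-sym G {u} {v} e = trans (Graph.sym G v u) e

module _ {n : ℕ} {G : Graph n} where

  _++ʷ_ : ∀ {u v w} → Walk G u v → Walk G v w → Walk G u w
  []      ++ʷ q = q
  (e ∷ p) ++ʷ q = e ∷ (p ++ʷ q)

  reverseʷ : ∀ {u v} → Walk G u v → Walk G v u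
  reverseʷ []      = []
  reverseʷ (e ∷ p) = reverseʷ p ++ʷ (adj-sym G e ∷ [])

record Levelling {n : ℕ} (G : Graph n) (root : Fin n) : Set where
  field
    level           : Fin n → ℕ
    level-root      : level root ≡ 0
    level≡0⇒root    : ∀ {u} → level u ≡ 0 → u ≡ root
    adjacent-levels : ∀ {u v} → Adj G u v → level v ≡ suc (level u) ⊎ level u ≡ suc (level v)
    parent-unique   : ∀ {u v w} → Adj G u v → Adj G u w →
                      level u ≡ suc (level v) → level u ≡ suc (level w) → v ≡ w
    parent-exists   : ∀ {u k} → level u ≡ suc k → ∃[ v ] Adj G u v × level v ≡ k

module _ {n : ℕ} {G : Graph n} {root : Fin n} (L : Levelling G root) where
  open Levelling L

  walk-to-root : ∀ k u → level u ≡ k → Walk G u root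
  walk-to-root zero    u e = subst (Walk G u) (level≡0⇒root e) []
  walk-to-root (suc k) u e with parent-exists e
  ... | v , u~v , e′ = u~v ∷ walk-to-root k v e′

  levelling⇒connected : Connected G
  levelling⇒connected u v = walk-to-root _ u refl ++ʷ reverseʷ (walk-to-root _ v refl)

  Ascending Descending : List (Fin n) → Set
  Ascending  = Linked (λ u v → level v ≡ suc (level u))
  Descending = Linked (λ u v → level u ≡ suc (level v))

  no-peak : ∀ {x y z zs} → Unique (x ∷ y ∷ z ∷ zs) → Adj G x y → Adj G y z →
            ¬ (level y ≡ suc (level x) × level y ≡ suc (level z))
  no-peak ((_ ∷ x≢z ∷ _) ∷ _) x~y y~z (up , down) = x≢z (parent-unique (adj-sym G x~y) y~z up down)

  ascending-walk : ∀ {x y zs} → Unique (x ∷ y ∷ zs) → Linked (Adj G) (x ∷ y ∷ zs) →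
                   level y ≡ suc (level x) → Ascending (x ∷ y ∷ zs)
  ascending-walk {zs = []}     _ _ up = up ∷ [-]
  ascending-walk {zs = z ∷ zs} U@(_ ∷ U′) (x~y ∷ W@(y~z ∷ _)) up with adjacent-levels y~z
  ... | inj₁ up′   = up ∷ ascending-walk U′ W up′
  ... | inj₂ down = ⊥-elim (no-peak U x~y y~z (up , down))

  data EndsDescending : List (Fin n) → Set where
    here  : ∀ {y z} → level y ≡ suc (level z) → EndsDescending (y ∷ z ∷ [])
    there : ∀ {x ys} → EndsDescending ys → EndsDescending (x ∷ ys)

  ends-descending : ∀ xs {y z} → level y ≡ suc (level z) → EndsDescending (xs ∷ʳ y ∷ʳ z)
  ends-descending []       down = here down
  ends-descending (x ∷ xs) down = there (ends-descending xs down)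

  descending-walk : ∀ {xs} → Unique xs → Linked (Adj G) xs → EndsDescending xs → Descending xs
  descending-walk _ _ (here down) = down ∷ [-]
  descending-walk _ (_ ∷ [-]) (there (there ()))
  descending-walk U@(_ ∷ U′) (x~y ∷ W@(y~z ∷ _)) (there e) with descending-walk U′ W e
  ... | D@(down ∷ _) with adjacent-levels x~y
  ...   | inj₂ down′ = down′ ∷ D
  ...   | inj₁ up    = ⊥-elim (no-peak U x~y y~z (up , down))

  rises : ∀ {x xs} → Ascending (x ∷ xs) → All (λ w → level x < level w) xs
  rises [-]      = []
  rises (up ∷ A) = Linked⇒All <-trans (≡-suc⇒< up) (Linked.map ≡-suc⇒< A)

  falls : ∀ {x xs} → Descending (x ∷ xs) → All (λ w → level w < level x) xs
  falls [-]        = []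
  falls (down ∷ D) = Linked⇒All (λ p q → <-trans q p) (≡-suc⇒< down) (Linked.map ≡-suc⇒< D)

  -- A closed walk u y₁ … yk u that leaves u upwards keeps rising and cannot return to u.  If it
  -- leaves downwards, y₁ is the parent of u, so it enters u from above (yk cannot be a second
  -- parent), and a walk that ends going down descends all the way: u would lie below y₁.
  closed-walk-impossible : ∀ {u y₁ yk} xs → Unique (u ∷ y₁ ∷ xs ∷ʳ yk) →
                           Linked (Adj G) (u ∷ y₁ ∷ xs ∷ʳ yk ∷ʳ u) → ⊥
  closed-walk-impossible {u} {y₁} {yk} xs U@(_ ∷ y₁∉ ∷ _) W@(u~y₁ ∷ W-tail) =
    first-and-last (adjacent-levels u~y₁) (adjacent-levels yk~u)
    where
      yk~u = proj₂ (Linked-∷ʳ⁻ (u ∷ y₁ ∷ xs) W)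

      rising : level y₁ ≡ suc (level u) → Ascending (u ∷ y₁ ∷ xs ∷ʳ yk)
      rising = ascending-walk U (proj₁ (Linked-∷ʳ⁻ (u ∷ y₁ ∷ xs) W))

      falling : level yk ≡ suc (level u) → Descending (y₁ ∷ xs ∷ʳ yk ∷ʳ u)
      falling = descending-walk (Unique-rotate _ U) W-tail ∘ ends-descending (y₁ ∷ xs)

      first-and-last : level y₁ ≡ suc (level u) ⊎ level u ≡ suc (level y₁) →
                       level u ≡ suc (level yk) ⊎ level yk ≡ suc (level u) → ⊥
      first-and-last (inj₁ up)   (inj₁ last-up)   =
        <-asym (All-∷ʳ-last {xs = y₁ ∷ xs} (rises (rising up))) (≡-suc⇒< last-up)
      first-and-last (inj₁ up)   (inj₂ last-down) =
        <-asym (All-∷ʳ-last (rises (Linked.tail (rising up)))) (All-∷ʳ-last (All-∷ʳ-init (falls (falling last-down))))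
      first-and-last (inj₂ down) (inj₁ last-up)   = All-∷ʳ-last y₁∉ (parent-unique u~y₁ (adj-sym G yk~u) down last-up)
      first-and-last (inj₂ down) (inj₂ last-down) = <-asym (≡-suc⇒< down) (All-∷ʳ-last (falls (falling last-down)))

  levelling⇒acyclic : Acyclic G
  levelling⇒acyclic (u , ys , two≤ , U , W) with initLast ys
  levelling⇒acyclic (_ , _ , () , _ , _) | []
  levelling⇒acyclic (_ , _ , s≤s () , _ , _) | [] ∷ʳ′ _
  levelling⇒acyclic (_ , _ , _ , U , W) | (y₁ ∷ xs) ∷ʳ′ yk = closed-walk-impossible xs U W

eventual-deg : ∀ {n} → Graph n → Fin n → ℕ → Fin n → ℕ
eventual-deg G port e u = deg G u + (if does (u ≟ port) then e else 0)

eventual-deg-port : ∀ {n} (G : Graph n) port e → eventual-deg G port e port ≡ deg G port + e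
eventual-deg-port G port e rewrite dec-true (port ≟ port) refl = refl

eventual-deg-0 : ∀ {n} (G : Graph n) port u → eventual-deg G port 0 u ≡ deg G u
eventual-deg-0 G port u with does (u ≟ port)
... | true  = +-identityʳ _
... | false = +-identityʳ _

-- e more edges will be attached at the port, giving it degree D.
record Admissible {n} (G : Graph n) (port : Fin n) (e D : ℕ) : Set where
  field
    port-deg      : deg G port + e ≡ D
    deg≤3         : ∀ u → eventual-deg G port e u ≤ 3
    no-adjacent-2 : ∀ u v → Adj G u v → ¬ (eventual-deg G port e u ≡ 2 × eventual-deg G port e v ≡ 2)

admissible-port : ∀ {n} {G : Graph n} {port e D} → Admissible G port e D → eventual-deg G port e port ≡ D
admissible-port {G = G} {port} {e} adm = trans (eventual-deg-port G port e) (Admissible.port-deg adm)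

admissible⇒degree-conditions : ∀ {n} {G : Graph n} {port D} → Admissible G port 0 D →
                                MaxDegreeAtMost3 G × NoAdjacentDegree2 G
admissible⇒degree-conditions {G = G} {port} adm =
  (λ u → subst (_≤ 3) (eventual-deg-0 G port u) (deg≤3 u)) ,
  (λ u v u~v (p , q) → no-adjacent-2 u v u~v (trans (eventual-deg-0 G port u) p , trans (eventual-deg-0 G port v) q))
  where open Admissible adm

neighbours-pair⇒deg≡2 : ∀ {n} (G : Graph n) {u v w} → v ≢ w → Adj G u v → Adj G u w →
                        (∀ x → Adj G u x → x ≡ v ⊎ x ≡ w) → deg G u ≡ 2
neighbours-pair⇒deg≡2 G {u} {v} {w} v≢w u~v u~w only =
  trans (count-cong neighbour) (trans (count-∨ _ _ disjoint) (cong₂ _+_ (count-≟ v) (count-≟ w)))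
  where
    neighbour : ∀ x → Graph.adj G u x ≡ (does (x ≟ v) ∨ does (x ≟ w))
    neighbour x with Graph.adj G u x in e | x ≟ v | x ≟ w
    ... | true  | yes _    | _        = refl
    ... | true  | no _     | yes _    = refl
    ... | true  | no x≢v   | no x≢w   = ⊥-elim ([ x≢v , x≢w ] (only x e))
    ... | false | yes refl | _        with () ← trans (sym e) u~v
    ... | false | no _     | yes refl with () ← trans (sym e) u~w
    ... | false | no _     | no _     = refl

    disjoint : ∀ x → does (x ≟ v) ∧ does (x ≟ w) ≡ false
    disjoint x with x ≟ v | x ≟ w
    ... | yes refl | yes refl = ⊥-elim (v≢w refl)
    ... | yes _    | no _     = refl
    ... | no _     | _        = refl

matching⇒legal : ∀ {n} {G : Graph n} → NoAdjacentDegree2 G → ∀ {M} → IsMatching G M → IsLegal G M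
matching⇒legal {G = G} no-2-2 {M} (M-sym , M⊆G , M-disjoint)
  (u , v , ((u~v , Muv) , only-u , only-v) , (w , Muw) , (w′ , Mvw′)) =
  no-2-2 u v u~v
    ( neighbours-pair⇒deg≡2 G (λ { refl → false≢true (trans (sym Muv) Muw) }) u~v (M⊆G u w Muw) (neighbours Muw only-u)
    , neighbours-pair⇒deg≡2 G (λ { refl → false≢true (trans (sym (trans (M-sym v u) Muv)) Mvw′) })
                              (adj-sym G u~v) (M⊆G v w′ Mvw′) (neighbours Mvw′ only-v) )
  where
    neighbours : ∀ {p q r} → M p r ≡ true → (∀ z → AdjMinus G M p z → z ≡ q) → ∀ x → Adj G p x → x ≡ q ⊎ x ≡ r
    neighbours {p} Mpr only x p~x with M p x in e
    ... | true  = inj₂ (M-disjoint p x _ e Mpr)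
    ... | false = inj₁ (only x (p~x , e))

Avoids : ∀ {n} → (Fin n → Fin n → Bool) → Fin n → Set
Avoids M port = ∀ v → M port v ≡ false

record MatchingFamily {n} (G : Graph n) (port : Fin n) : Set where
  field
    avoiding    : List (EdgeSet G)
    others      : List (EdgeSet G)
    avoiding-ok : All (λ M → IsMatching G M × Avoids M port) avoiding
    others-ok   : All (IsMatching G) others
    distinct    : AllPairs (DistinctEdgeSets G) (avoiding ++ others)

  census : ℕ × ℕ
  census = length avoiding , length others

-- Joining two pieces by a bridge edge

does-≟-injective : ∀ {p q} (f : Fin p → Fin q) → (∀ {x y} → f x ≡ f y → x ≡ y) →
                   ∀ x y → does (f x ≟ f y) ≡ does (x ≟ y)
does-≟-injective f f-inj x y with x ≟ y
... | yes refl = dec-true (f x ≟ f x) refl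
... | no x≢y   = dec-false (f x ≟ f y) (x≢y ∘ f-inj)

splitAt-injective : ∀ m {k} {u v : Fin (m + k)} → splitAt m u ≡ splitAt m v → u ≡ v
splitAt-injective m {k} {u} {v} e =
  trans (sym (join-splitAt m k u)) (trans (cong (join m k) e) (join-splitAt m k v))

module Bridge {m k : ℕ} (A : Graph m) (B : Graph k) (a : Fin m) (b : Fin k) where

  is-bridge : Fin m → Fin k → Bool
  is-bridge x y = does (x ≟ a) ∧ does (y ≟ b)

  is-bridge⇒ends : ∀ x y → is-bridge x y ≡ true → x ≡ a × y ≡ b
  is-bridge⇒ends x y e with x ≟ a | y ≟ b
  is-bridge⇒ends x y refl | yes refl | yes refl = refl , refl
  is-bridge⇒ends x y ()   | no _     | _
  is-bridge⇒ends x y ()   | yes _    | no _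

  is-bridge-ends : is-bridge a b ≡ true
  is-bridge-ends = cong₂ _∧_ (dec-true (a ≟ a) refl) (dec-true (b ≟ b) refl)

  Vertex : Set
  Vertex = Fin m ⊎ Fin k

  adj⊎ : Vertex → Vertex → Bool
  adj⊎ (inj₁ x) (inj₁ y) = Graph.adj A x y
  adj⊎ (inj₂ x) (inj₂ y) = Graph.adj B x y
  adj⊎ (inj₁ x) (inj₂ y) = is-bridge x y
  adj⊎ (inj₂ y) (inj₁ x) = is-bridge x y

  adj⊎-sym : ∀ s t → adj⊎ s t ≡ adj⊎ t s
  adj⊎-sym (inj₁ x) (inj₁ y) = Graph.sym A x y
  adj⊎-sym (inj₁ x) (inj₂ y) = refl
  adj⊎-sym (inj₂ y) (inj₁ x) = refl
  adj⊎-sym (inj₂ x) (inj₂ y) = Graph.sym B x y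

  adj⊎-irrefl : ∀ s → adj⊎ s s ≡ false
  adj⊎-irrefl (inj₁ x) = Graph.irrefl A x
  adj⊎-irrefl (inj₂ y) = Graph.irrefl B y

  graph : Graph (m + k)
  graph = record
    { adj    = λ u v → adj⊎ (splitAt m u) (splitAt m v)
    ; sym    = λ u v → adj⊎-sym (splitAt m u) (splitAt m v)
    ; irrefl = λ u → adj⊎-irrefl (splitAt m u)
    }

  inl : Fin m → Fin (m + k)
  inl x = x ↑ˡ k

  inr : Fin k → Fin (m + k)
  inr y = m ↑ʳ y

  splitAt-inl : ∀ x → splitAt m (inl x) ≡ inj₁ x
  splitAt-inl x = splitAt-↑ˡ m x k

  splitAt-inr : ∀ y → splitAt m (inr y) ≡ inj₂ y
  splitAt-inr y = splitAt-↑ʳ m k y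

  data Side : Fin (m + k) → Set where
    left  : ∀ x → Side (inl x)
    right : ∀ y → Side (inr y)

  side : ∀ u → Side u
  side u with splitAt m u in eq
  ... | inj₁ x = subst Side (splitAt⁻¹-↑ˡ eq) (left x)
  ... | inj₂ y = subst Side (splitAt⁻¹-↑ʳ eq) (right y)

  inl≢inr : ∀ {x y} → inl x ≢ inr y
  inl≢inr {x} {y} e with trans (sym (splitAt-inl x)) (trans (cong (splitAt m) e) (splitAt-inr y))
  ... | ()

  adj-inl-inl : ∀ x y → Graph.adj graph (inl x) (inl y) ≡ Graph.adj A x y
  adj-inl-inl x y rewrite splitAt-inl x | splitAt-inl y = refl

  adj-inr-inr : ∀ x y → Graph.adj graph (inr x) (inr y) ≡ Graph.adj B x y
  adj-inr-inr x y rewrite splitAt-inr x | splitAt-inr y = refl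

  adj-inl-inr : ∀ x y → Graph.adj graph (inl x) (inr y) ≡ is-bridge x y
  adj-inl-inr x y rewrite splitAt-inl x | splitAt-inr y = refl

  adj-inr-inl : ∀ y x → Graph.adj graph (inr y) (inl x) ≡ is-bridge x y
  adj-inr-inl y x rewrite splitAt-inl x | splitAt-inr y = refl

  module _ {r : Fin m} (LA : Levelling A r) (LB : Levelling B b) where
    private
      module LA = Levelling LA
      module LB = Levelling LB

    level⊎ : Vertex → ℕ
    level⊎ (inj₁ x) = LA.level x
    level⊎ (inj₂ y) = suc (LA.level a + LB.level y)

    private
      raise : ∀ {p q : ℕ} → p ≡ suc q → suc (LA.level a + p) ≡ suc (suc (LA.level a + q))
      raise {q = q} e = cong suc (trans (cong (LA.level a +_) e) (+-suc (LA.level a) q))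

      lower : ∀ {p q : ℕ} → suc (LA.level a + p) ≡ suc (suc (LA.level a + q)) → p ≡ suc q
      lower {q = q} e = +-cancelˡ-≡ (LA.level a) _ _ (trans (suc-injective e) (sym (+-suc (LA.level a) q)))

      level-inr-b : level⊎ (inj₂ b) ≡ suc (LA.level a)
      level-inr-b = cong suc (trans (cong (LA.level a +_) LB.level-root) (+-identityʳ _))

      a-above-B : ∀ y → LA.level a ≢ suc (level⊎ (inj₂ y))
      a-above-B y e = m≢1+m+n (LA.level a) (trans e (cong suc (sym (+-suc _ (LB.level y)))))

      b-above-B : ∀ z → LB.level b ≢ suc (LB.level z)
      b-above-B z e with trans (sym LB.level-root) e
      ... | ()

    adjacent-levels⊎ : ∀ s t → adj⊎ s t ≡ true → level⊎ t ≡ suc (level⊎ s) ⊎ level⊎ s ≡ suc (level⊎ t)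
    adjacent-levels⊎ (inj₁ x) (inj₁ y) e = LA.adjacent-levels e
    adjacent-levels⊎ (inj₂ x) (inj₂ y) e with LB.adjacent-levels e
    ... | inj₁ up   = inj₁ (raise up)
    ... | inj₂ down = inj₂ (raise down)
    adjacent-levels⊎ (inj₁ x) (inj₂ y) e with is-bridge⇒ends x y e
    ... | refl , refl = inj₁ level-inr-b
    adjacent-levels⊎ (inj₂ y) (inj₁ x) e with is-bridge⇒ends x y e
    ... | refl , refl = inj₂ level-inr-b

    parent-unique⊎ : ∀ s t t′ → adj⊎ s t ≡ true → adj⊎ s t′ ≡ true →
                     level⊎ s ≡ suc (level⊎ t) → level⊎ s ≡ suc (level⊎ t′) → t ≡ t′
    parent-unique⊎ (inj₁ x) (inj₁ y) (inj₁ y′) e₁ e₂ h₁ h₂ = cong inj₁ (LA.parent-unique e₁ e₂ h₁ h₂)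
    parent-unique⊎ (inj₁ x) (inj₂ y) t′ e₁ e₂ h₁ h₂ with is-bridge⇒ends x y e₁
    ... | refl , refl = ⊥-elim (a-above-B y h₁)
    parent-unique⊎ (inj₁ x) (inj₁ y) (inj₂ y′) e₁ e₂ h₁ h₂ with is-bridge⇒ends x y′ e₂
    ... | refl , refl = ⊥-elim (a-above-B y′ h₂)
    parent-unique⊎ (inj₂ y) (inj₂ z) (inj₂ z′) e₁ e₂ h₁ h₂ = cong inj₂ (LB.parent-unique e₁ e₂ (lower h₁) (lower h₂))
    parent-unique⊎ (inj₂ y) (inj₁ x) (inj₁ x′) e₁ e₂ h₁ h₂ with is-bridge⇒ends x y e₁ | is-bridge⇒ends x′ y e₂
    ... | refl , _ | refl , _ = refl
    parent-unique⊎ (inj₂ y) (inj₁ x) (inj₂ z) e₁ e₂ h₁ h₂ with is-bridge⇒ends x y e₁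
    ... | _ , refl = ⊥-elim (b-above-B z (lower h₂))
    parent-unique⊎ (inj₂ y) (inj₂ z) (inj₁ x) e₁ e₂ h₁ h₂ with is-bridge⇒ends x y e₂
    ... | _ , refl = ⊥-elim (b-above-B z (lower h₁))

    parent-exists⊎ : ∀ s {j} → level⊎ s ≡ suc j → ∃[ t ] adj⊎ s t ≡ true × level⊎ t ≡ j
    parent-exists⊎ (inj₁ x) e with LA.parent-exists e
    ... | y , x~y , ey = inj₁ y , x~y , ey
    parent-exists⊎ (inj₂ y) e with LB.level y in ey
    ... | zero with LB.level≡0⇒root ey
    ...   | refl = inj₁ a , is-bridge-ends , trans (sym (+-identityʳ _)) (suc-injective e)
    parent-exists⊎ (inj₂ y) e | suc l with LB.parent-exists ey
    ... | z , y~z , ez = inj₂ z , y~z , trans (cong (λ q → suc (LA.level a + q)) ez) (trans (sym (+-suc _ l)) (suc-injective e))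

    levelling : Levelling graph (inl r)
    levelling = record
      { level           = λ u → level⊎ (splitAt m u)
      ; level-root      = trans (cong level⊎ (splitAt-inl r)) LA.level-root
      ; level≡0⇒root    = root
      ; adjacent-levels = λ {u} {v} → adjacent-levels⊎ (splitAt m u) (splitAt m v)
      ; parent-unique   = λ {u} {v} {w} e₁ e₂ h₁ h₂ →
                            splitAt-injective m (parent-unique⊎ (splitAt m u) (splitAt m v) (splitAt m w) e₁ e₂ h₁ h₂)
      ; parent-exists   = parent
      }
      where
        root : ∀ {u} → level⊎ (splitAt m u) ≡ 0 → u ≡ inl r
        root {u} e with splitAt m u in eq
        ... | inj₁ x = trans (sym (splitAt⁻¹-↑ˡ eq)) (cong inl (LA.level≡0⇒root e))

        parent : ∀ {u j} → level⊎ (splitAt m u) ≡ suc j → ∃[ v ] Adj graph u v × level⊎ (splitAt m v) ≡ j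
        parent {u} e with parent-exists⊎ (splitAt m u) e
        ... | t , u~t , et = join m k t
                           , subst (λ s → adj⊎ (splitAt m u) s ≡ true) (sym (splitAt-join m k t)) u~t
                           , subst (λ s → level⊎ s ≡ _) (sym (splitAt-join m k t)) et

  deg-inl : ∀ x → deg graph (inl x) ≡ deg A x + (if does (x ≟ a) then 1 else 0)
  deg-inl x = begin
    deg graph (inl x)                                      ≡⟨ count-↑ m (Graph.adj graph (inl x)) ⟩
    count (λ y → Graph.adj graph (inl x) (inl y)) + count (λ y → Graph.adj graph (inl x) (inr y))
      ≡⟨ cong₂ _+_ (count-cong (adj-inl-inl x)) (count-cong (adj-inl-inr x)) ⟩
    deg A x + count (is-bridge x)                          ≡⟨ cong (deg A x +_) (count-if-≟ (does (x ≟ a)) b) ⟩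
    deg A x + (if does (x ≟ a) then 1 else 0)              ∎
    where open ≡-Reasoning

  deg-inr : ∀ y → deg graph (inr y) ≡ deg B y + (if does (y ≟ b) then 1 else 0)
  deg-inr y = begin
    deg graph (inr y)                                      ≡⟨ count-↑ m (Graph.adj graph (inr y)) ⟩
    count (λ x → Graph.adj graph (inr y) (inl x)) + count (λ z → Graph.adj graph (inr y) (inr z))
      ≡⟨ cong₂ _+_ (count-cong (λ x → trans (adj-inr-inl y x) (∧-comm (does (x ≟ a)) _))) (count-cong (adj-inr-inr y)) ⟩
    count (λ x → does (y ≟ b) ∧ does (x ≟ a)) + deg B y    ≡⟨ cong (_+ deg B y) (count-if-≟ (does (y ≟ b)) a) ⟩
    (if does (y ≟ b) then 1 else 0) + deg B y              ≡⟨ +-comm _ (deg B y) ⟩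
    deg B y + (if does (y ≟ b) then 1 else 0)              ∎
    where open ≡-Reasoning

  does-inl≟inl : ∀ x y → does (inl x ≟ inl y) ≡ does (x ≟ y)
  does-inl≟inl = does-≟-injective inl (↑ˡ-injective k _ _)

  does-inr≟inr : ∀ x y → does (inr x ≟ inr y) ≡ does (x ≟ y)
  does-inr≟inr = does-≟-injective inr (↑ʳ-injective m _ _)

  does-inl≟inr : ∀ x y → does (inl x ≟ inr y) ≡ false
  does-inl≟inr x y = dec-false (inl x ≟ inr y) inl≢inr

  does-inr≟inl : ∀ y x → does (inr y ≟ inl x) ≡ false
  does-inr≟inl y x = dec-false (inr y ≟ inl x) (inl≢inr ∘ sym)

  admissible-join : ∀ {port e D pA eA DA pB eB DB} → Admissible A pA eA DA → Admissible B pB eB DB →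
                    (∀ x → eventual-deg graph port e (inl x) ≡ eventual-deg A pA eA x) →
                    (∀ y → eventual-deg graph port e (inr y) ≡ eventual-deg B pB eB y) →
                    ¬ (eventual-deg A pA eA a ≡ 2 × eventual-deg B pB eB b ≡ 2) →
                    deg graph port + e ≡ D → Admissible graph port e D
  admissible-join {port} {e} adm-A adm-B on-A on-B bridge-ok port-deg = record
    { port-deg      = port-deg
    ; deg≤3         = deg≤3
    ; no-adjacent-2 = no-adjacent-2
    }
    where
      module A′ = Admissible adm-A
      module B′ = Admissible adm-B

      deg≤3 : ∀ u → eventual-deg graph port e u ≤ 3
      deg≤3 u with side u
      ... | left x  = subst (_≤ 3) (sym (on-A x)) (A′.deg≤3 x)
      ... | right y = subst (_≤ 3) (sym (on-B y)) (B′.deg≤3 y)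

      no-adjacent-2 : ∀ u v → Adj graph u v → ¬ (eventual-deg graph port e u ≡ 2 × eventual-deg graph port e v ≡ 2)
      no-adjacent-2 u v u~v (p , q) with side u | side v
      ... | left x  | left y  = A′.no-adjacent-2 x y (trans (sym (adj-inl-inl x y)) u~v) (trans (sym (on-A x)) p , trans (sym (on-A y)) q)
      ... | right x | right y = B′.no-adjacent-2 x y (trans (sym (adj-inr-inr x y)) u~v) (trans (sym (on-B x)) p , trans (sym (on-B y)) q)
      ... | left x  | right y with is-bridge⇒ends x y (trans (sym (adj-inl-inr x y)) u~v)
      ...   | refl , refl = bridge-ok (trans (sym (on-A a)) p , trans (sym (on-B b)) q)
      no-adjacent-2 u v u~v (p , q) | right y | left x with is-bridge⇒ends x y (trans (sym (adj-inr-inl y x)) u~v)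
      ...   | refl , refl = bridge-ok (trans (sym (on-A a)) q , trans (sym (on-B b)) p)

  attach-admissible : ∀ {e DA DB} → Admissible A a (suc e) DA → Admissible B b 1 DB → ¬ (DA ≡ 2 × DB ≡ 2) →
                      Admissible graph (inl a) e DA
  attach-admissible {e} adm-A adm-B bridge-ok =
    admissible-join adm-A adm-B on-A on-B
      (λ (p , q) → bridge-ok (trans (sym (admissible-port adm-A)) p , trans (sym (admissible-port adm-B)) q))
      (trans (sym (eventual-deg-port graph (inl a) e)) (trans (on-A a) (admissible-port adm-A)))
    where
      on-A : ∀ x → eventual-deg graph (inl a) e (inl x) ≡ eventual-deg A a (suc e) x
      on-A x rewrite deg-inl x | does-inl≟inl x a with does (x ≟ a)
      ... | true  = +-assoc (deg A x) 1 e
      ... | false = +-identityʳ _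

      on-B : ∀ y → eventual-deg graph (inl a) e (inr y) ≡ eventual-deg B b 1 y
      on-B y rewrite deg-inr y | does-inr≟inl y a = +-identityʳ _

  extend-admissible : ∀ {e DA DB} → Admissible A a 1 DA → Admissible B b (suc e) DB → ¬ (DA ≡ 2 × DB ≡ 2) →
                      Admissible graph (inr b) e DB
  extend-admissible {e} adm-A adm-B bridge-ok =
    admissible-join adm-A adm-B on-A on-B
      (λ (p , q) → bridge-ok (trans (sym (admissible-port adm-A)) p , trans (sym (admissible-port adm-B)) q))
      (trans (sym (eventual-deg-port graph (inr b) e)) (trans (on-B b) (admissible-port adm-B)))
    where
      on-A : ∀ x → eventual-deg graph (inr b) e (inl x) ≡ eventual-deg A a 1 x
      on-A x rewrite deg-inl x | does-inl≟inr x b = +-identityʳ _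

      on-B : ∀ y → eventual-deg graph (inr b) e (inr y) ≡ eventual-deg B b (suc e) y
      on-B y rewrite deg-inr y | does-inr≟inr y b with does (y ≟ b)
      ... | true  = +-assoc (deg B y) 1 e
      ... | false = +-identityʳ _

  glue⊎ : Bool → EdgeSet A → EdgeSet B → Vertex → Vertex → Bool
  glue⊎ t MA MB (inj₁ x) (inj₁ y) = MA x y
  glue⊎ t MA MB (inj₂ x) (inj₂ y) = MB x y
  glue⊎ t MA MB (inj₁ x) (inj₂ y) = t ∧ is-bridge x y
  glue⊎ t MA MB (inj₂ y) (inj₁ x) = t ∧ is-bridge x y

  glue : Bool → EdgeSet A → EdgeSet B → EdgeSet graph
  glue t MA MB u v = glue⊎ t MA MB (splitAt m u) (splitAt m v)

  glue-matching : ∀ {t MA MB} → IsMatching A MA → IsMatching B MB →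
                  (t ≡ true → Avoids MA a × Avoids MB b) → IsMatching graph (glue t MA MB)
  glue-matching {t} {MA} {MB} (A-sym , A⊆ , A-disjoint) (B-sym , B⊆ , B-disjoint) bridge-free =
    (λ u v → sym⊎ (splitAt m u) (splitAt m v)) ,
    (λ u v → ⊆⊎ (splitAt m u) (splitAt m v)) ,
    (λ u v w e₁ e₂ → splitAt-injective m (disjoint⊎ (splitAt m u) (splitAt m v) (splitAt m w) e₁ e₂))
    where
      g = glue⊎ t MA MB

      sym⊎ : ∀ s s′ → g s s′ ≡ g s′ s
      sym⊎ (inj₁ x) (inj₁ y) = A-sym x y
      sym⊎ (inj₁ x) (inj₂ y) = refl
      sym⊎ (inj₂ y) (inj₁ x) = refl
      sym⊎ (inj₂ x) (inj₂ y) = B-sym x y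

      ⊆⊎ : ∀ s s′ → g s s′ ≡ true → adj⊎ s s′ ≡ true
      ⊆⊎ (inj₁ x) (inj₁ y) e = A⊆ x y e
      ⊆⊎ (inj₁ x) (inj₂ y) e = proj₂ (∧-true⁻ t e)
      ⊆⊎ (inj₂ y) (inj₁ x) e = proj₂ (∧-true⁻ t e)
      ⊆⊎ (inj₂ x) (inj₂ y) e = B⊆ x y e

      no-mixedˡ : ∀ x y y′ → MA x y ≡ true → t ∧ is-bridge x y′ ≡ true → ⊥
      no-mixedˡ x y y′ e₁ e₂ with ∧-true⁻ t e₂
      ... | t≡true , e with is-bridge⇒ends x y′ e
      ...   | refl , _ with () ← trans (sym (proj₁ (bridge-free t≡true) y)) e₁

      no-mixedʳ : ∀ y z x → MB y z ≡ true → t ∧ is-bridge x y ≡ true → ⊥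
      no-mixedʳ y z x e₁ e₂ with ∧-true⁻ t e₂
      ... | t≡true , e with is-bridge⇒ends x y e
      ...   | _ , refl with () ← trans (sym (proj₂ (bridge-free t≡true) z)) e₁

      disjoint⊎ : ∀ s s′ s″ → g s s′ ≡ true → g s s″ ≡ true → s′ ≡ s″
      disjoint⊎ (inj₁ x) (inj₁ y) (inj₁ y′) e₁ e₂ = cong inj₁ (A-disjoint x y y′ e₁ e₂)
      disjoint⊎ (inj₂ x) (inj₂ y) (inj₂ y′) e₁ e₂ = cong inj₂ (B-disjoint x y y′ e₁ e₂)
      disjoint⊎ (inj₁ x) (inj₂ y) (inj₂ y′) e₁ e₂
        with is-bridge⇒ends x y (proj₂ (∧-true⁻ t e₁)) | is-bridge⇒ends x y′ (proj₂ (∧-true⁻ t e₂))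
      ... | _ , refl | _ , refl = refl
      disjoint⊎ (inj₂ y) (inj₁ x) (inj₁ x′) e₁ e₂
        with is-bridge⇒ends x y (proj₂ (∧-true⁻ t e₁)) | is-bridge⇒ends x′ y (proj₂ (∧-true⁻ t e₂))
      ... | refl , _ | refl , _ = refl
      disjoint⊎ (inj₁ x) (inj₁ y) (inj₂ y′) e₁ e₂ = ⊥-elim (no-mixedˡ x y y′ e₁ e₂)
      disjoint⊎ (inj₁ x) (inj₂ y′) (inj₁ y) e₁ e₂ = ⊥-elim (no-mixedˡ x y y′ e₂ e₁)
      disjoint⊎ (inj₂ y) (inj₂ y′) (inj₁ x) e₁ e₂ = ⊥-elim (no-mixedʳ y y′ x e₁ e₂)
      disjoint⊎ (inj₂ y) (inj₁ x) (inj₂ y′) e₁ e₂ = ⊥-elim (no-mixedʳ y y′ x e₂ e₁)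

  glue-avoids-inl : ∀ {MA MB} → Avoids MA a → Avoids (glue false MA MB) (inl a)
  glue-avoids-inl a-free v rewrite splitAt-inl a with splitAt m v
  ... | inj₁ x = a-free x
  ... | inj₂ y = refl

  glue-avoids-inr : ∀ {MA MB} → Avoids MB b → Avoids (glue false MA MB) (inr b)
  glue-avoids-inr b-free v rewrite splitAt-inr b with splitAt m v
  ... | inj₁ x = refl
  ... | inj₂ y = b-free y

  glue-distinctˡ : ∀ {t t′ MA MA′ MB MB′} → DistinctEdgeSets A MA MA′ →
                   DistinctEdgeSets graph (glue t MA MB) (glue t′ MA′ MB′)
  glue-distinctˡ (x , y , ≢) = inl x , inl y , λ e → ≢ (subst₂ _≡_ (at x y) (at x y) e)
    where
      at : ∀ x y {t MA MB} → glue t MA MB (inl x) (inl y) ≡ MA x y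
      at x y rewrite splitAt-inl x | splitAt-inl y = refl

  glue-distinctʳ : ∀ {t t′ MA MA′ MB MB′} → DistinctEdgeSets B MB MB′ →
                   DistinctEdgeSets graph (glue t MA MB) (glue t′ MA′ MB′)
  glue-distinctʳ (x , y , ≢) = inr x , inr y , λ e → ≢ (subst₂ _≡_ (at x y) (at x y) e)
    where
      at : ∀ x y {t MA MB} → glue t MA MB (inr x) (inr y) ≡ MB x y
      at x y rewrite splitAt-inr x | splitAt-inr y = refl

  glue-distinct-bridge : ∀ {MA MA′ MB MB′} → DistinctEdgeSets graph (glue false MA MB) (glue true MA′ MB′)
  glue-distinct-bridge = inl a , inr b , λ e → false≢true (trans (sym (at false)) (trans e (at true)))
    where
      at : ∀ t {MA MB} → glue t MA MB (inl a) (inr b) ≡ t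
      at t rewrite splitAt-inl a | splitAt-inr b | is-bridge-ends = ∧-identityʳ t

  module _ (FA : MatchingFamily A a) (FB : MatchingFamily B b) where
    private
      module FA = MatchingFamily FA
      module FB = MatchingFamily FB

      _⊗_ _⊛_ : List (EdgeSet A) → List (EdgeSet B) → List (EdgeSet graph)
      _⊗_ = cartesianProductWith (glue false)
      _⊛_ = cartesianProductWith (glue true)

      Distinct = DistinctEdgeSets graph

      allA = FA.avoiding ++ FA.others
      allB = FB.avoiding ++ FB.others

      allA-ok : All (IsMatching A) allA
      allA-ok = Allₚ.++⁺ (All.map proj₁ FA.avoiding-ok) FA.others-ok

      allB-ok : All (IsMatching B) allB
      allB-ok = Allₚ.++⁺ (All.map proj₁ FB.avoiding-ok) FB.others-ok

      bridged = FA.avoiding ⊛ FB.avoiding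

      bridged-ok : All (IsMatching graph) bridged
      bridged-ok = All-cartesianProductWith⁺ (glue true)
        (λ (mA , freeA) (mB , freeB) → glue-matching mA mB (λ _ → freeA , freeB)) FA.avoiding-ok FB.avoiding-ok

      bridged-distinct : AllPairs Distinct bridged
      bridged-distinct = AllPairs-cartesianProductWith⁺ (glue true) glue-distinctˡ glue-distinctʳ
        (proj₁ (AllPairs-++⁻ FA.avoiding FA.distinct)) (proj₁ (AllPairs-++⁻ FB.avoiding FB.distinct))

      unbridged-vs-bridged : ∀ xs ys → All (λ M → All (Distinct M) bridged) (xs ⊗ ys)
      unbridged-vs-bridged = All-cartesianProductWith-universal (glue false)
        (λ _ _ → All-cartesianProductWith-universal (glue true) (λ _ _ → glue-distinct-bridge) FA.avoiding FB.avoiding)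

      unbridged-ok : ∀ {xs ys} → All (IsMatching A) xs → All (IsMatching B) ys → All (IsMatching graph) (xs ⊗ ys)
      unbridged-ok = All-cartesianProductWith⁺ (glue false) (λ mA mB → glue-matching mA mB (λ ()))

    attach-family : MatchingFamily graph (inl a)
    attach-family = record
      { avoiding    = FA.avoiding ⊗ allB
      ; others      = FA.others ⊗ allB ++ bridged
      ; avoiding-ok = All-cartesianProductWith⁺ (glue false)
                        (λ (mA , freeA) mB → glue-matching mA mB (λ ()) , glue-avoids-inl freeA) FA.avoiding-ok allB-ok
      ; others-ok   = Allₚ.++⁺ (unbridged-ok FA.others-ok allB-ok) bridged-ok
      ; distinct    = subst (AllPairs Distinct) regroup
                        (AllPairsₚ.++⁺ (AllPairs-cartesianProductWith⁺ (glue false) glue-distinctˡ glue-distinctʳ FA.distinct FB.distinct)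
                                      bridged-distinct (unbridged-vs-bridged allA allB))
      }
      where
        regroup : allA ⊗ allB ++ bridged ≡ FA.avoiding ⊗ allB ++ (FA.others ⊗ allB ++ bridged)
        regroup = trans (cong (_++ bridged) (cartesianProductWith-distribʳ-++ (glue false) FA.avoiding FA.others allB))
                        (++-assoc (FA.avoiding ⊗ allB) _ _)

    extend-family : MatchingFamily graph (inr b)
    extend-family = record
      { avoiding    = allA ⊗ FB.avoiding
      ; others      = allA ⊗ FB.others ++ bridged
      ; avoiding-ok = All-cartesianProductWith⁺ (glue false)
                        (λ mA (mB , freeB) → glue-matching mA mB (λ ()) , glue-avoids-inr freeB) allA-ok FB.avoiding-ok
      ; others-ok   = Allₚ.++⁺ (unbridged-ok allA-ok FB.others-ok) bridged-ok
      ; distinct    = subst (AllPairs Distinct) (++-assoc (allA ⊗ FB.avoiding) _ _)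
                        (AllPairsₚ.++⁺ (AllPairsₚ.++⁺ (pairs B-avoiding) (pairs B-others) avoiding-vs-others)
                                      bridged-distinct
                                      (Allₚ.++⁺ (unbridged-vs-bridged allA FB.avoiding) (unbridged-vs-bridged allA FB.others)))
      }
      where
        B-avoiding = proj₁ (AllPairs-++⁻ FB.avoiding FB.distinct)
        B-others   = proj₁ (proj₂ (AllPairs-++⁻ FB.avoiding FB.distinct))
        B-across   = proj₂ (proj₂ (AllPairs-++⁻ FB.avoiding FB.distinct))

        pairs : ∀ {ys} → AllPairs (DistinctEdgeSets B) ys → AllPairs Distinct (allA ⊗ ys)
        pairs = AllPairs-cartesianProductWith⁺ (glue false) glue-distinctˡ glue-distinctʳ FA.distinct

        everywhere : All (λ _ → ⊤) allA
        everywhere = All.universal (λ _ → tt) allA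

        avoiding-vs-others : All (λ M → All (Distinct M) (allA ⊗ FB.others)) (allA ⊗ FB.avoiding)
        avoiding-vs-others = All-cartesianProductWith⁺ (glue false)
          (λ _ across → All-cartesianProductWith⁺ (glue false) (λ _ d → glue-distinctʳ d) everywhere across)
          everywhere B-across

    private
      uA = length FA.avoiding
      cA = length FA.others
      uB = length FB.avoiding
      cB = length FB.others

      length-⊗ : ∀ {t} xs ys → length (cartesianProductWith (glue t) xs ys) ≡ length xs * length ys
      length-⊗ {t} = length-cartesianProductWith (glue t)

    attach-census : MatchingFamily.census attach-family ≡ (uA * (uB + cB) , cA * (uB + cB) + uA * uB)
    attach-census = cong₂ _,_
      (trans (length-⊗ FA.avoiding allB) (cong (uA *_) (length-++ FB.avoiding)))
      (trans (length-++ (FA.others ⊗ allB))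
             (cong₂ _+_ (trans (length-⊗ FA.others allB) (cong (cA *_) (length-++ FB.avoiding)))
                        (length-⊗ FA.avoiding FB.avoiding)))

    extend-census : MatchingFamily.census extend-family ≡ ((uA + cA) * uB , (uA + cA) * cB + uA * uB)
    extend-census = cong₂ _,_
      (trans (length-⊗ allA FB.avoiding) (cong (_* uB) (length-++ FA.avoiding)))
      (trans (length-++ (allA ⊗ FB.others))
             (cong₂ _+_ (trans (length-⊗ allA FB.others) (cong (_* cB) (length-++ FA.avoiding)))
                        (length-⊗ FA.avoiding FB.avoiding)))

point : Graph 1
point = record { adj = λ _ _ → false ; sym = λ _ _ → refl ; irrefl = λ _ → refl }

record Branch (e D : ℕ) : Set where
  field
    size       : ℕ
    graph      : Graph size
    port       : Fin size
    levelling  : Levelling graph port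
    matchings  : MatchingFamily graph port
    admissible : Admissible graph port e D

record Chain (e D : ℕ) : Set where
  field
    size       : ℕ
    graph      : Graph size
    root       : Fin size
    port       : Fin size
    levelling  : Levelling graph root
    matchings  : MatchingFamily graph port
    admissible : Admissible graph port e D

vertex : ∀ {e} → e ≤ 3 → Branch e e
vertex e≤3 = record
  { size       = 1
  ; graph      = point
  ; port       = Fin.zero
  ; levelling  = record
      { level = λ _ → 0 ; level-root = refl ; level≡0⇒root = λ { {Fin.zero} _ → refl }
      ; adjacent-levels = λ () ; parent-unique = λ () ; parent-exists = λ () }
  ; matchings  = record
      { avoiding = (λ _ _ → false) ∷ [] ; others = []
      ; avoiding-ok = (((λ _ _ → refl) , (λ _ _ ()) , (λ _ _ _ ())) , (λ _ → refl)) ∷ []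
      ; others-ok = [] ; distinct = [] ∷ [] }
  ; admissible = record { port-deg = refl ; deg≤3 = λ { Fin.zero → e≤3 } ; no-adjacent-2 = λ _ _ () }
  }

branch⇒chain : ∀ {e D} → Branch e D → Chain e D
branch⇒chain X = record { Branch X ; root = Branch.port X }

module _ {e D D′ : ℕ} where

  attach-branch : Branch (suc e) D → Branch 1 D′ → ¬ (D ≡ 2 × D′ ≡ 2) → Branch e D
  attach-branch X Y bridge-ok = record
    { size       = X.size + Y.size
    ; graph      = J.graph
    ; port       = J.inl X.port
    ; levelling  = J.levelling X.levelling Y.levelling
    ; matchings  = J.attach-family X.matchings Y.matchings
    ; admissible = J.attach-admissible X.admissible Y.admissible bridge-ok
    }
    where
      module X = Branch X
      module Y = Branch Y
      module J = Bridge X.graph Y.graph X.port Y.port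

  attach : Chain (suc e) D → Branch 1 D′ → ¬ (D ≡ 2 × D′ ≡ 2) → Chain e D
  attach X Y bridge-ok = record
    { size       = X.size + Y.size
    ; graph      = J.graph
    ; root       = J.inl X.root
    ; port       = J.inl X.port
    ; levelling  = J.levelling X.levelling Y.levelling
    ; matchings  = J.attach-family X.matchings Y.matchings
    ; admissible = J.attach-admissible X.admissible Y.admissible bridge-ok
    }
    where
      module X = Chain X
      module Y = Branch Y
      module J = Bridge X.graph Y.graph X.port Y.port

module _ {D e D′ : ℕ} where

  extend : Chain 1 D → Branch (suc e) D′ → ¬ (D ≡ 2 × D′ ≡ 2) → Chain e D′
  extend X Y bridge-ok = record
    { size       = X.size + Y.size
    ; graph      = J.graph
    ; root       = J.inl X.root
    ; port       = J.inr Y.port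
    ; levelling  = J.levelling X.levelling Y.levelling
    ; matchings  = J.extend-family X.matchings Y.matchings
    ; admissible = J.extend-admissible X.admissible Y.admissible bridge-ok
    }
    where
      module X = Chain X
      module Y = Branch Y
      module J = Bridge X.graph Y.graph X.port Y.port

branch-census : ∀ {e D} → Branch e D → ℕ × ℕ
branch-census X = MatchingFamily.census (Branch.matchings X)

census : ∀ {e D} → Chain e D → ℕ × ℕ
census X = MatchingFamily.census (Chain.matchings X)

attach-census : ∀ {e D D′} (X : Chain (suc e) D) (Y : Branch 1 D′) bridge-ok →
                let (u , c) = census X ; (uY , cY) = branch-census Y in
                census (attach X Y bridge-ok) ≡ (u * (uY + cY) , c * (uY + cY) + u * uY)
attach-census X Y _ =
  Bridge.attach-census (Chain.graph X) (Branch.graph Y) (Chain.port X) (Branch.port Y) (Chain.matchings X) (Branch.matchings Y)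

extend-census : ∀ {D e D′} (X : Chain 1 D) (Y : Branch (suc e) D′) bridge-ok →
                let (u , c) = census X ; (uY , cY) = branch-census Y in
                census (extend X Y bridge-ok) ≡ ((u + c) * uY , (u + c) * cY + u * uY)
extend-census X Y _ =
  Bridge.extend-census (Chain.graph X) (Branch.graph Y) (Chain.port X) (Branch.port Y) (Chain.matchings X) (Branch.matchings Y)

chain⇒tree : ∀ {D} (X : Chain 0 D) → let (u , c) = census X in
             Σ (Graph (Chain.size X)) λ T → IsTree T × MaxDegreeAtMost3 T × NoAdjacentDegree2 T × AtLeastLegalMatchings T (u + c)
chain⇒tree X =
  X.graph , (levelling⇒connected X.levelling , levelling⇒acyclic X.levelling) , max-deg , no-2-2 ,
  F.avoiding ++ F.others , length-++ F.avoiding ,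
  Allₚ.++⁺ (All.map (λ (matching , _) → legal matching) F.avoiding-ok) (All.map legal F.others-ok) ,
  F.distinct
  where
    module X = Chain X
    module F = MatchingFamily X.matchings
    max-deg : MaxDegreeAtMost3 X.graph
    max-deg = proj₁ (admissible⇒degree-conditions X.admissible)

    no-2-2 : NoAdjacentDegree2 X.graph
    no-2-2 = proj₂ (admissible⇒degree-conditions X.admissible)

    legal : ∀ {M} → IsMatching X.graph M → IsLegalMatching X.graph M
    legal matching = matching , matching⇒legal {G = X.graph} no-2-2 matching

-- Transfer matrices

record Matrix : Set where
  constructor matrix
  field a b c d : ℕ

apply : Matrix → ℕ × ℕ → ℕ × ℕ
apply (matrix a b c d) (u , v) = a * u + b * v , c * u + d * v

_⊙_ : Matrix → Matrix → Matrix
matrix a b c d ⊙ matrix a′ b′ c′ d′ = matrix (a * a′ + b * c′) (a * b′ + b * d′) (c * a′ + d * c′) (c * b′ + d * d′)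

identity : Matrix
identity = matrix 1 0 0 1

apply-identity : ∀ v → apply identity v ≡ v
apply-identity (u , v) = cong₂ _,_ (unitˡ u v) (unitʳ u v)
  where
    unitˡ : ∀ x y → 1 * x + 0 * y ≡ x
    unitˡ = solve-∀
    unitʳ : ∀ x y → 0 * x + 1 * y ≡ y
    unitʳ = solve-∀

apply-⊙ : ∀ M N v → apply (M ⊙ N) v ≡ apply M (apply N v)
apply-⊙ (matrix a b c d) (matrix a′ b′ c′ d′) (u , v) =
  cong₂ _,_ (row a b a′ b′ c′ d′ u v) (row c d a′ b′ c′ d′ u v)
  where
    row : ∀ x y a′ b′ c′ d′ u v →
          (x * a′ + y * c′) * u + (x * b′ + y * d′) * v ≡ x * (a′ * u + b′ * v) + y * (c′ * u + d′ * v)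
    row = solve-∀

_≤²_ : ℕ × ℕ → ℕ × ℕ → Set
(u , v) ≤² (u′ , v′) = u ≤ u′ × v ≤ v′

apply-mono : ∀ M {p q} → p ≤² q → apply M p ≤² apply M q
apply-mono (matrix a b c d) (u≤u′ , v≤v′) =
  +-mono-≤ (*-monoʳ-≤ a u≤u′) (*-monoʳ-≤ b v≤v′) , +-mono-≤ (*-monoʳ-≤ c u≤u′) (*-monoʳ-≤ d v≤v′)

extension-matrix : ℕ × ℕ → Matrix
extension-matrix (uY , cY) = matrix uY uY (uY + cY) cY

extend-apply : ∀ {D e D′} (X : Chain 1 D) (Y : Branch (suc e) D′) bridge-ok →
               census (extend X Y bridge-ok) ≡ apply (extension-matrix (branch-census Y)) (census X)
extend-apply X Y bridge-ok = trans (extend-census X Y bridge-ok) (cong₂ _,_ (linear₁ u c uY) (linear₂ u c uY cY))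
  where
    u  = proj₁ (census X)
    c  = proj₂ (census X)
    uY = proj₁ (branch-census Y)
    cY = proj₂ (branch-census Y)
    linear₁ : ∀ u c uY → (u + c) * uY ≡ uY * u + uY * c
    linear₁ = solve-∀
    linear₂ : ∀ u c uY cY → (u + c) * cY + u * uY ≡ (uY + cY) * u + cY * c
    linear₂ = solve-∀

data Spine (D : ℕ) : ℕ → Set where
  []   : Spine D D
  step : ∀ {D′ D″} (Y : Branch 2 D′) → ¬ (D ≡ 2 × D′ ≡ 2) → Spine D′ D″ → Spine D D″

extend-along : ∀ {D D′} → Chain 1 D → Spine D D′ → Chain 1 D′
extend-along X []                   = X
extend-along X (step Y bridge-ok s) = extend-along (extend X Y bridge-ok) s

spine-size : ∀ {D D′} → Spine D D′ → ℕ
spine-size []           = 0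
spine-size (step Y _ s) = Branch.size Y + spine-size s

spine-matrix : ∀ {D D′} → Spine D D′ → Matrix
spine-matrix []           = identity
spine-matrix (step Y _ s) = spine-matrix s ⊙ extension-matrix (branch-census Y)

size-extend-along : ∀ {D D′} (X : Chain 1 D) (s : Spine D D′) → Chain.size (extend-along X s) ≡ Chain.size X + spine-size s
size-extend-along X []                   = sym (+-identityʳ _)
size-extend-along X (step Y bridge-ok s) = trans (size-extend-along (extend X Y bridge-ok) s) (+-assoc (Chain.size X) _ _)

census-extend-along : ∀ {D D′} (X : Chain 1 D) (s : Spine D D′) → census (extend-along X s) ≡ apply (spine-matrix s) (census X)
census-extend-along X []                   = sym (apply-identity (census X))
census-extend-along X (step Y bridge-ok s) = begin
  census (extend-along (extend X Y bridge-ok) s)                 ≡⟨ census-extend-along (extend X Y bridge-ok) s ⟩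
  apply (spine-matrix s) (census (extend X Y bridge-ok))         ≡⟨ cong (apply (spine-matrix s)) (extend-apply X Y bridge-ok) ⟩
  apply (spine-matrix s) (apply (extension-matrix (branch-census Y)) (census X)) ≡⟨ apply-⊙ (spine-matrix s) _ (census X) ⟨
  apply (spine-matrix (step Y bridge-ok s)) (census X)           ∎
  where open ≡-Reasoning

-- The gadget

bridge-ok-3ʳ : ∀ {D} → ¬ (D ≡ 2 × 3 ≡ 2)
bridge-ok-3ʳ (_ , ())

bridge-ok-3ˡ : ∀ {D} → ¬ (3 ≡ 2 × D ≡ 2)
bridge-ok-3ˡ (() , _)

bridge-ok-1ʳ : ∀ {D} → ¬ (D ≡ 2 × 1 ≡ 2)
bridge-ok-1ʳ (_ , ())

leaf : Branch 1 1
leaf = vertex (s≤s z≤n)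

path₂ : Branch 1 2
path₂ = attach-branch (vertex (s≤s (s≤s z≤n))) leaf bridge-ok-1ʳ

spider : Branch 1 3
spider = attach-branch (attach-branch (vertex ≤-refl) path₂ bridge-ok-3ˡ) path₂ bridge-ok-3ˡ

stalked-spider : Branch 1 2
stalked-spider = attach-branch (vertex (s≤s (s≤s z≤n))) spider bridge-ok-3ʳ

spine-bare : Branch 2 2
spine-bare = vertex (s≤s (s≤s z≤n))

spine-leaf : Branch 2 3
spine-leaf = attach-branch (vertex ≤-refl) leaf bridge-ok-3ˡ

spine-path : Branch 2 3
spine-path = attach-branch (vertex ≤-refl) path₂ bridge-ok-3ˡ

spine-spider : Branch 2 3
spine-spider = attach-branch (vertex ≤-refl) stalked-spider bridge-ok-3ˡ

gadget-spine : ∀ {D} → Spine D 2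
gadget-spine =
  step spine-path bridge-ok-3ʳ (step spine-path bridge-ok-3ʳ (step spine-bare bridge-ok-3ˡ
  (step spine-spider bridge-ok-3ʳ (step spine-spider bridge-ok-3ʳ (step spine-bare bridge-ok-3ˡ [])))))

-- Trace 2 · 13384 and determinant 576², so the Perron root is β.
gadget-matrix : Matrix
gadget-matrix = matrix 20336 13456 9696 6432

gadget-spine-matrix : ∀ {D} → spine-matrix (gadget-spine {D}) ≡ gadget-matrix
gadget-spine-matrix = refl

gadget-spine-size : ∀ {D} → spine-size (gadget-spine {D}) ≡ 22
gadget-spine-size = refl

-- Powers of β

A B : ℕ → ℕ
A k = proj₁ (βPow k)
B k = proj₂ (βPow k)

βPow-suc : ∀ k → βPow (suc k) ≡ (13384 * A k + 8 * B k * D₀ , 8 * A k + 13384 * B k)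
βPow-suc k with βPow k
... | _ = refl

A-suc : ∀ k → A (suc k) ≡ 13384 * A k + 8 * B k * D₀
A-suc k = cong proj₁ (βPow-suc k)

B-suc : ∀ k → B (suc k) ≡ 8 * A k + 13384 * B k
B-suc k = cong proj₂ (βPow-suc k)

-- 1671 < √D₀
1671*B≤A : ∀ k → 1671 * B k ≤ A k
1671*B≤A zero    = z≤n
1671*B≤A (suc k) = begin
  1671 * B (suc k)                                  ≡⟨ cong (1671 *_) (B-suc k) ⟩
  1671 * (8 * A k + 13384 * B k)                    ≡⟨ expand₁ (A k) (B k) ⟩
  13368 * A k + 22349960 * B k + 16 * (919 * B k)   ≤⟨ +-monoʳ-≤ (13368 * A k + 22349960 * B k) (*-monoʳ-≤ 16 919*B≤A) ⟩
  13368 * A k + 22349960 * B k + 16 * A k           ≡⟨ expand₂ (A k) (B k) ⟨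
  13384 * A k + 8 * B k * D₀                        ≡⟨ A-suc k ⟨
  A (suc k)                                         ∎
  where
    open ≤-Reasoning
    919*B≤A : 919 * B k ≤ A k
    919*B≤A = ≤-trans (*-monoˡ-≤ (B k) (m≤m+n 919 752)) (1671*B≤A k)
    expand₁ : ∀ a b → 1671 * (8 * a + 13384 * b) ≡ 13368 * a + 22349960 * b + 16 * (919 * b)
    expand₁ = solve-∀
    expand₂ : ∀ a b → 13384 * a + 8 * b * 2793745 ≡ 13368 * a + 22349960 * b + 16 * a
    expand₂ = solve-∀

D₀*B*B≤2*A*A : ∀ m k → D₀ * B m * B k ≤ 2 * A m * A k
D₀*B*B≤2*A*A m k = *-cancelˡ-≤ (1671 * 1671) (begin
  1671 * 1671 * (D₀ * B m * B k)       ≡⟨ regroup₁ 1671 D₀ (B m) (B k) ⟩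
  D₀ * (1671 * B m) * (1671 * B k)     ≤⟨ *-mono-≤ (*-monoʳ-≤ D₀ (1671*B≤A m)) (1671*B≤A k) ⟩
  D₀ * A m * A k                       ≤⟨ *-monoˡ-≤ (A k) (*-monoˡ-≤ (A m) D₀≤2*1671²) ⟩
  1671 * 1671 * 2 * A m * A k          ≡⟨ regroup₂ 1671 (A m) (A k) ⟩
  1671 * 1671 * (2 * A m * A k)        ∎)
  where
    open ≤-Reasoning
    D₀≤2*1671² : D₀ ≤ 1671 * 1671 * 2
    D₀≤2*1671² = ≤ᵇ⇒≤ D₀ (1671 * 1671 * 2) tt
    regroup₁ : ∀ c d x y → c * c * (d * x * y) ≡ d * (c * x) * (c * y)
    regroup₁ = solve-∀
    regroup₂ : ∀ c x y → c * c * 2 * x * y ≡ c * c * (2 * x * y)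
    regroup₂ = solve-∀

A-B-+ : ∀ m k → A (m + k) ≡ A m * A k + D₀ * B m * B k × B (m + k) ≡ A m * B k + B m * A k
A-B-+ zero    k = unit₁ D₀ (A k) (B k) , unit₂ (A k) (B k)
  where
    unit₁ : ∀ d a b → a ≡ 1 * a + d * 0 * b
    unit₁ = solve-∀
    unit₂ : ∀ a b → b ≡ 1 * b + 0 * a
    unit₂ = solve-∀
A-B-+ (suc m) k = A-suc-+ , B-suc-+
  where
    open ≡-Reasoning
    A-+ = proj₁ (A-B-+ m k)
    B-+ = proj₂ (A-B-+ m k)

    A-suc-+ : A (suc m + k) ≡ A (suc m) * A k + D₀ * B (suc m) * B k
    A-suc-+ = begin
      A (suc (m + k))                                                    ≡⟨ A-suc (m + k) ⟩
      13384 * A (m + k) + 8 * B (m + k) * D₀                             ≡⟨ cong₂ (λ x y → 13384 * x + 8 * y * D₀) A-+ B-+ ⟩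
      13384 * (A m * A k + D₀ * B m * B k) + 8 * (A m * B k + B m * A k) * D₀
        ≡⟨ distribute (A m) (B m) (A k) (B k) D₀ ⟩
      (13384 * A m + 8 * B m * D₀) * A k + D₀ * (8 * A m + 13384 * B m) * B k
        ≡⟨ cong₂ (λ x y → x * A k + D₀ * y * B k) (A-suc m) (B-suc m) ⟨
      A (suc m) * A k + D₀ * B (suc m) * B k                             ∎
      where
        distribute : ∀ a b a′ b′ d → 13384 * (a * a′ + d * b * b′) + 8 * (a * b′ + b * a′) * d
                                   ≡ (13384 * a + 8 * b * d) * a′ + d * (8 * a + 13384 * b) * b′
        distribute = solve-∀

    B-suc-+ : B (suc m + k) ≡ A (suc m) * B k + B (suc m) * A k
    B-suc-+ = begin
      B (suc (m + k))                                                    ≡⟨ B-suc (m + k) ⟩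
      8 * A (m + k) + 13384 * B (m + k)                                  ≡⟨ cong₂ (λ x y → 8 * x + 13384 * y) A-+ B-+ ⟩
      8 * (A m * A k + D₀ * B m * B k) + 13384 * (A m * B k + B m * A k) ≡⟨ distribute (A m) (B m) (A k) (B k) D₀ ⟩
      (13384 * A m + 8 * B m * D₀) * B k + (8 * A m + 13384 * B m) * A k
        ≡⟨ cong₂ (λ x y → x * B k + y * A k) (A-suc m) (B-suc m) ⟨
      A (suc m) * B k + B (suc m) * A k                                  ∎
      where
        distribute : ∀ a b a′ b′ d → 8 * (a * a′ + d * b * b′) + 13384 * (a * b′ + b * a′)
                                   ≡ (13384 * a + 8 * b * d) * b′ + (8 * a + 13384 * b) * a′
        distribute = solve-∀

A-+-≤ : ∀ m k → A (m + k) ≤ 3 * A m * A k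
A-+-≤ m k = begin
  A (m + k)                      ≡⟨ proj₁ (A-B-+ m k) ⟩
  A m * A k + D₀ * B m * B k     ≤⟨ +-monoʳ-≤ (A m * A k) (D₀*B*B≤2*A*A m k) ⟩
  A m * A k + 2 * A m * A k      ≡⟨ collect (A m) (A k) ⟩
  3 * A m * A k                  ∎
  where
    open ≤-Reasoning
    collect : ∀ x y → x * y + 2 * x * y ≡ 3 * x * y
    collect = solve-∀

A-*-≤ : ∀ j k → A (j * k) ≤ 3 ^ j * A k ^ j
A-*-≤ zero    k = ≤-refl
A-*-≤ (suc j) k = begin
  A (k + j * k)                  ≤⟨ A-+-≤ k (j * k) ⟩
  3 * A k * A (j * k)            ≤⟨ *-monoʳ-≤ (3 * A k) (A-*-≤ j k) ⟩
  3 * A k * (3 ^ j * A k ^ j)    ≡⟨ regroup (A k) (3 ^ j) (A k ^ j) ⟩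
  3 ^ suc j * A k ^ suc j        ∎
  where
    open ≤-Reasoning
    regroup : ∀ x t y → 3 * x * (t * y) ≡ 3 * t * (x * y)
    regroup = solve-∀

A-mono : ∀ {m n} → m ≤ n → A m ≤ A n
A-mono = mono ∘′ ≤⇒≤′
  where
    mono : ∀ {m n} → m ≤′ n → A m ≤ A n
    mono ≤′-refl        = ≤-refl
    mono (≤′-step {n} p) = ≤-trans (mono p) (begin
      A n                             ≤⟨ m≤n*m (A n) 13384 ⟩
      13384 * A n                     ≤⟨ m≤m+n (13384 * A n) (8 * B n * D₀) ⟩
      13384 * A n + 8 * B n * D₀      ≡⟨ A-suc n ⟨
      A (suc n)                       ∎)
      where open ≤-Reasoning

*-^ : ∀ m n k → (m * n) ^ k ≡ m ^ k * n ^ k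
*-^ m n zero    = refl
*-^ m n (suc k) = trans (cong (m * n *_) (*-^ m n k)) (regroup m n (m ^ k) (n ^ k))
  where
    regroup : ∀ m n x y → m * n * (x * y) ≡ m * x * (n * y)
    regroup = solve-∀

n≤n^1+k : ∀ n k → 1 ≤ n → n ≤ n ^ suc k
n≤n^1+k n k 1≤n = begin
  n           ≡⟨ *-identityʳ n ⟨
  n * 1       ≡⟨ cong (n *_) (^-zeroˡ k) ⟨
  n * 1 ^ k   ≤⟨ *-monoʳ-≤ n (^-monoˡ-≤ k 1≤n) ⟩
  n * n ^ k   ∎
  where open ≤-Reasoning

geq-surd : ∀ {X a b d} → 3 * a ≤ X → d * b * b ≤ 2 * a * a → GeqSurd X a b d
geq-surd {X} {a} {b} {d} 3a≤X db²≤2a² = ≤-trans (m≤n*m a 3) 3a≤X , (begin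
  b * b * d                  ≡⟨ regroup₁ b d ⟩
  d * b * b                  ≤⟨ db²≤2a² ⟩
  2 * a * a                  ≤⟨ *-monoˡ-≤ a (*-monoˡ-≤ a (m≤m+n 2 2)) ⟩
  4 * a * a                  ≡⟨ regroup₂ a ⟩
  (2 * a) * (2 * a)          ≤⟨ *-mono-≤ 2a≤X∸a 2a≤X∸a ⟩
  (X ∸ a) * (X ∸ a)          ∎)
  where
    open ≤-Reasoning
    regroup₁ : ∀ b d → b * b * d ≡ d * b * b
    regroup₁ = solve-∀
    regroup₂ : ∀ a → 4 * a * a ≡ (2 * a) * (2 * a)
    regroup₂ = solve-∀
    2a≤X∸a : 2 * a ≤ X ∸ a
    2a≤X∸a = begin
      2 * a                  ≡⟨ m+n∸m≡n a (2 * a) ⟨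
      a + 2 * a ∸ a          ≡⟨ cong (_∸ a) (three a) ⟩
      3 * a ∸ a              ≤⟨ ∸-monoˡ-≤ a 3a≤X ⟩
      X ∸ a                  ∎
      where
        three : ∀ a → a + 2 * a ≡ 3 * a
        three = solve-∀

GeqSurd⇒GeqCAlphaPow : ∀ K p q n → GeqSurd ((q * K) ^ 22) (p ^ 22 * A n) (p ^ 22 * B n) D₀ → GeqCAlphaPow K p q n
GeqSurd⇒GeqCAlphaPow K p q n g with βPow n
... | _ = g

c₀ : ℕ
c₀ = 9 * A 26

3*A≤[c*K]^22 : ∀ r k K → r ≤ 26 → A k ≤ K → 3 * A (r + 22 * k) ≤ (suc c₀ * K) ^ 22
3*A≤[c*K]^22 r k K r≤26 Ak≤K = begin
  3 * A (r + 22 * k)                       ≤⟨ *-monoʳ-≤ 3 (A-+-≤ r (22 * k)) ⟩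
  3 * (3 * A r * A (22 * k))               ≤⟨ *-monoʳ-≤ 3 (*-mono-≤ (*-monoʳ-≤ 3 (A-mono r≤26)) (A-*-≤ 22 k)) ⟩
  3 * (3 * A 26 * (3 ^ 22 * A k ^ 22))     ≡⟨ regroup (A 26) (3 ^ 22) (A k ^ 22) ⟩
  9 * 3 ^ 22 * A 26 * A k ^ 22             ≤⟨ *-mono-≤ {9 * 3 ^ 22 * A 26} {9 ^ 22 * A 26 ^ 22}
                                                 (*-mono-≤ {9 * 3 ^ 22} {9 ^ 22} (≤ᵇ⇒≤ (9 * 3 ^ 22) (9 ^ 22) tt)
                                                                                (n≤n^1+k (A 26) 21 (A-mono {0} {26} z≤n)))
                                                 (^-monoˡ-≤ 22 Ak≤K) ⟩
  9 ^ 22 * A 26 ^ 22 * K ^ 22              ≡⟨ cong (_* K ^ 22) (*-^ 9 (A 26) 22) ⟨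
  c₀ ^ 22 * K ^ 22                         ≤⟨ *-monoˡ-≤ (K ^ 22) (^-monoˡ-≤ 22 (n≤1+n c₀)) ⟩
  suc c₀ ^ 22 * K ^ 22                     ≡⟨ *-^ (suc c₀) K 22 ⟨
  (suc c₀ * K) ^ 22                        ∎
  where
    open ≤-Reasoning
    regroup : ∀ a t y → 3 * (3 * a * (t * y)) ≡ 9 * t * a * y
    regroup = solve-∀

A≤⇒GeqCAlphaPow : ∀ r k K → r ≤ 26 → A k ≤ K → GeqCAlphaPow K 1 (suc c₀) (r + 22 * k)
A≤⇒GeqCAlphaPow r k K r≤26 Ak≤K =
  GeqSurd⇒GeqCAlphaPow K 1 (suc c₀) n
    (subst₂ (λ a b → GeqSurd _ a b D₀) (sym (*-identityˡ (A n))) (sym (*-identityˡ (B n)))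
            (geq-surd {a = A n} {b = B n} {d = D₀} (3*A≤[c*K]^22 r k K r≤26 Ak≤K) (D₀*B*B≤2*A*A n n)))
  where
    n = r + 22 * k

β-image : ℕ → ℕ × ℕ
β-image k = A k + 869 * B k , 1212 * B k

gadget-matrix-β-image : ∀ k → apply gadget-matrix (β-image k) ≡ β-image (suc k)
gadget-matrix-β-image k = cong₂ _,_
  (trans (intertwine₁ (A k) (B k)) (sym (cong₂ (λ a b → a + 869 * b) (A-suc k) (B-suc k))))
  (trans (intertwine₂ (A k) (B k)) (sym (cong (1212 *_) (B-suc k))))
  where
    intertwine₁ : ∀ a b → 20336 * (a + 869 * b) + 13456 * (1212 * b) ≡ 13384 * a + 8 * b * 2793745 + 869 * (8 * a + 13384 * b)
    intertwine₁ = solve-∀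
    intertwine₂ : ∀ a b → 9696 * (a + 869 * b) + 6432 * (1212 * b) ≡ 1212 * (8 * a + 13384 * b)
    intertwine₂ = solve-∀

gadgets : ∀ {D} → ℕ → Chain 1 D → ∃ (Chain 1)
gadgets zero    X = _ , X
gadgets (suc k) X = _ , extend-along (proj₂ (gadgets k X)) gadget-spine

size-gadgets : ∀ {D} k (X : Chain 1 D) → Chain.size (proj₂ (gadgets k X)) ≡ Chain.size X + 22 * k
size-gadgets zero    X = sym (+-identityʳ _)
size-gadgets (suc k) X = begin
  Chain.size (extend-along Y gadget-spine)   ≡⟨ size-extend-along Y gadget-spine ⟩
  Chain.size Y + spine-size (gadget-spine {D}) ≡⟨ cong (Chain.size Y +_) (gadget-spine-size {D}) ⟩
  Chain.size Y + 22                          ≡⟨ cong (_+ 22) (size-gadgets k X) ⟩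
  Chain.size X + 22 * k + 22                 ≡⟨ regroup (Chain.size X) k ⟩
  Chain.size X + 22 * suc k                  ∎
  where
    open ≡-Reasoning
    D = proj₁ (gadgets k X)
    Y = proj₂ (gadgets k X)
    regroup : ∀ s k → s + 22 * k + 22 ≡ s + 22 * suc k
    regroup = solve-∀

census-gadgets : ∀ {D} k (X : Chain 1 D) → β-image 0 ≤² census X → β-image k ≤² census (proj₂ (gadgets k X))
census-gadgets zero    X start = start
census-gadgets (suc k) X start =
  subst₂ _≤²_ (gadget-matrix-β-image k) (sym one-more) (apply-mono gadget-matrix (census-gadgets k X start))
  where
    D = proj₁ (gadgets k X)
    Y = proj₂ (gadgets k X)
    one-more : census (extend-along Y gadget-spine) ≡ apply gadget-matrix (census Y)
    one-more = trans (census-extend-along Y gadget-spine) (cong (λ M → apply M (census Y)) (gadget-spine-matrix {D}))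

prefix : ℕ → Chain 1 3
prefix zero          = extend (branch⇒chain leaf) spine-path bridge-ok-3ʳ
prefix (suc zero)    = extend (extend (branch⇒chain leaf) spine-leaf bridge-ok-3ʳ) spine-leaf bridge-ok-3ʳ
prefix (suc (suc i)) = extend (prefix i) spine-leaf bridge-ok-3ʳ

size-prefix : ∀ i → Chain.size (prefix i) ≡ 4 + i
size-prefix zero          = refl
size-prefix (suc zero)    = refl
size-prefix (suc (suc i)) = trans (cong (_+ 2) (size-prefix i)) (+-comm (4 + i) 2)

census-prefix : ∀ i → β-image 0 ≤² census (prefix i)
census-prefix zero          = s≤s z≤n , z≤n
census-prefix (suc zero)    = s≤s z≤n , z≤n
census-prefix (suc (suc i)) = ≤-trans (proj₁ (census-prefix i)) (begin
  u                                                      ≤⟨ m≤m+n u c ⟩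
  u + c                                                  ≡⟨ *-identityʳ (u + c) ⟨
  (u + c) * 1                                            ≡⟨ cong proj₁ (extend-census (prefix i) spine-leaf bridge-ok-3ʳ) ⟨
  proj₁ (census (prefix (suc (suc i))))                  ∎) , z≤n
  where
    open ≤-Reasoning
    u = proj₁ (census (prefix i))
    c = proj₂ (census (prefix i))

TreeWithManyLegalMatchings : ℕ → Set
TreeWithManyLegalMatchings n = Σ (Graph n) λ T → IsTree T × MaxDegreeAtMost3 T × NoAdjacentDegree2 T ×
                                 Σ ℕ λ K → AtLeastLegalMatchings T K × GeqCAlphaPow K 1 (suc c₀) n

tree-of-residue : ∀ i k → i < 22 → TreeWithManyLegalMatchings (5 + i + 22 * k)
tree-of-residue i k i<22 = subst TreeWithManyLegalMatchings size-F tree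
  where
    Z = proj₂ (gadgets k (prefix i))
    F = attach Z leaf bridge-ok-1ʳ
    u = proj₁ (census Z)
    K = proj₁ (census F) + proj₂ (census F)

    size-F : Chain.size F ≡ 5 + i + 22 * k
    size-F = trans (cong (_+ 1) (trans (size-gadgets k (prefix i)) (cong (_+ 22 * k) (size-prefix i)))) (regroup i k)
      where
        regroup : ∀ i k → 4 + i + 22 * k + 1 ≡ 5 + i + 22 * k
        regroup = solve-∀

    Ak≤K : A k ≤ K
    Ak≤K = begin
      A k                        ≤⟨ m≤m+n (A k) (869 * B k) ⟩
      A k + 869 * B k            ≤⟨ proj₁ (census-gadgets k (prefix i) (census-prefix i)) ⟩
      u                          ≡⟨ *-identityʳ u ⟨
      u * 1                      ≡⟨ cong proj₁ (attach-census Z leaf bridge-ok-1ʳ) ⟨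
      proj₁ (census F)           ≤⟨ m≤m+n _ _ ⟩
      K                          ∎
      where open ≤-Reasoning

    tree : TreeWithManyLegalMatchings (Chain.size F)
    tree = let T , is-tree , max-deg , no-2-2 , many = chain⇒tree F in
      T , is-tree , max-deg , no-2-2 , K , many ,
      subst (GeqCAlphaPow K 1 (suc c₀)) (sym size-F) (A≤⇒GeqCAlphaPow (5 + i) k K (+-monoʳ-≤ 5 (≤-pred i<22)) Ak≤K)

tree-of-size : ∀ n → 5 ≤ n → TreeWithManyLegalMatchings n
tree-of-size n 5≤n = subst TreeWithManyLegalMatchings size (tree-of-residue (m % 22) (m / 22) (m%n<n m 22))
  where
    m = n ∸ 5
    size : 5 + m % 22 + 22 * (m / 22) ≡ n
    size = begin
      5 + m % 22 + 22 * (m / 22)  ≡⟨ regroup (m % 22) (m / 22) ⟩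
      5 + (m % 22 + m / 22 * 22)  ≡⟨ cong (5 +_) (m≡m%n+[m/n]*n m 22) ⟨
      5 + m                       ≡⟨ m+[n∸m]≡n 5≤n ⟩
      n                           ∎
      where
        open ≡-Reasoning
        regroup : ∀ r q → 5 + r + 22 * q ≡ 5 + (r + q * 22)
        regroup = solve-∀

mainTheorem6 : ∃[ p ] ∃[ q ] ∃[ n₀ ] ((n : ℕ) → n ≥ n₀ → Σ (Graph n) λ T → IsTree T × MaxDegreeAtMost3 T × NoAdjacentDegree2 T × Σ ℕ λ K → AtLeastLegalMatchings T K × GeqCAlphaPow K (suc p) (suc q) n)
mainTheorem6 = 0 , c₀ , 5 , tree-of-size
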